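{- Let $r$ be a natural number and let $\beta_1,\dots,\beta_r\in[0,1]$ satisfy $\beta_1+\beta_2+\cdots+\beta_r=r-1$. Then for every natural number $k\leq r$, $$\sum_{i=1}^r(1-\beta_i)\beta_i^k\leq\left(\frac{r-1}{r}\right)^k.$$ -}

module Defs where

open import Level using (Level; _⊔_) renaming (suc to lsuc)
open import Data.Nat using (ℕ; zero; suc)
import Data.Fin as Fin
open import Data.Fin using (Fin)
open import Algebra.Bundles using (CommutativeRing)
open import Relation.Binary.Structures using (IsTotalOrder)
open import Relation.Nullary using (¬_)

-- An ordered field: a commutative ring with a total order compatible with
-- + and *, 0 ≠ 1, and a (total) inverse operation that is a genuine inverse
-- on nonzero elements (0⁻¹ is unconstrained, as in Mathlib).
-- The real numbers are an instance.
record OrderedField (c ℓ₁ ℓ₂ : Level) : Set (lsuc (c ⊔ ℓ₁ ⊔ ℓ₂)) where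
  field
    commutativeRing : CommutativeRing c ℓ₁
  open CommutativeRing commutativeRing public hiding (zero)
  infix 4 _≤_
  infix 8 _⁻¹
  field
    _≤_          : Carrier → Carrier → Set ℓ₂
    isTotalOrder : IsTotalOrder _≈_ _≤_
    +-mono-≤     : ∀ {x y} z → x ≤ y → x + z ≤ y + z
    *-nonneg     : ∀ {x y} → 0# ≤ x → 0# ≤ y → 0# ≤ x * y
    0≉1          : ¬ (0# ≈ 1#)
    _⁻¹          : Carrier → Carrier
    ⁻¹-inverse   : ∀ x → ¬ (x ≈ 0#) → x * (x ⁻¹) ≈ 1#

  fromℕ : ℕ → Carrier
  fromℕ zero    = 0#
  fromℕ (suc n) = 1# + fromℕ n

  infixr 9 _^_
  _^_ : Carrier → ℕ → Carrier
  x ^ zero  = 1#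
  x ^ suc n = x * (x ^ n)

  ∑ : ∀ r → (Fin r → Carrier) → Carrier
  ∑ zero    f = 0#
  ∑ (suc r) f = f Fin.zero + ∑ r (λ i → f (Fin.suc i))

  _÷_ : Carrier → Carrier → Carrier
  x ÷ y = x * (y ⁻¹)

module Submission where

-- Proof by a tangent-line (Jensen-type) argument.  Put a = 1/r and
-- q = 1 - a, the common value of the βᵢ in the extremal case.  For
-- g k u = (1 - u) u ^ k, the tangent line of g k at q lies above g k on
-- [0, ∞) provided k a ≤ 1: this follows by induction on k, because
-- u · (tangent for k) equals the tangent for k + 1 plus (slope k)(u - q)²,
-- and the slope of g k at q is q ^ (k-1) ((k+1) a - 1) ≤ 0.  Summing the
-- tangent lines over the βᵢ, whose mean is q, the linear parts cancel and
-- one is left with r · a · q ^ k = q ^ k.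

open import Defs
open import Level using (Level; 0ℓ)
open import Data.Nat using (ℕ; zero; suc; _∸_; z≤n; s≤s)
  renaming (_≤_ to _≤ℕ_; _+_ to _+ℕ_; _*_ to _*ℕ_)
import Data.Nat.Properties as ℕ
open import Data.Fin using (Fin)
import Data.Fin as Fin
open import Data.Product using (_×_; _,_; proj₁)
open import Data.Maybe using (Maybe; just; nothing)
open import Data.Sum using (inj₁; inj₂)
open import Data.Empty using (⊥-elim)
open import Relation.Nullary using (¬_; yes; no)
import Relation.Binary.PropositionalEquality as ≡
open import Relation.Binary.Bundles using (Poset)
open import Relation.Binary.Structures using (IsTotalOrder)
open import Algebra.Bundles using (CommutativeRing; RawRing)

-- The coefficients are
-- formal differences (a , b) of naturals, read as a·1 - b·1.  A coefficient
-- is interpreted through its reduced form (a ∸ b , b ∸ a), as m·1 or - (n·1),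
-- so that equal coefficients have definitionally equal denotations and the
-- constants 0 and 1 denote 0# and 1# on the nose; equality of coefficients
-- is decided by comparing a + d with c + b.
module DifferenceSolver {c ℓ} (R : CommutativeRing c ℓ) where
  open CommutativeRing R
  open import Algebra.Properties.Semiring.Mult.TCOptimised semiring
    using (×-homo-+; ×1-homo-*) renaming (_×_ to _×ᵤ_)
  open import Algebra.Properties.Ring ring using (x[y-z]≈xy-xz; [y-z]x≈yx-zx)
  open import Algebra.Properties.AbelianGroup +-abelianGroup using (⁻¹-anti-homo‿-; ⁻¹-∙-comm)
  open import Algebra.Properties.CommutativeSemigroup +-commutativeSemigroup
    using (interchange; xy∙z≈xz∙y)
  open import Algebra.Properties.Group +-group using (x≈z//y; //-rightDividesʳ; ε⁻¹≈ε)
  open import Algebra.Solver.Ring.AlmostCommutativeRing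
    using (fromCommutativeRing; _-Raw-AlmostCommutative⟶_)
  open import Relation.Binary.Reasoning.Setoid setoid

  private
    ι : ℕ → Carrier
    ι n = n ×ᵤ 1#

    cross-sub : ∀ {x y z w} → x + w ≈ z + y → x - y ≈ z - w
    cross-sub {x} {y} {z} {w} eq = x≈z//y (x - y) w z (begin
      (x - y) + w  ≈⟨ xy∙z≈xz∙y x (- y) w ⟩
      (x + w) - y  ≈⟨ +-congʳ eq ⟩
      (z + y) - y  ≈⟨ //-rightDividesʳ y z ⟩
      z            ∎)

    ι-cross : ∀ a b c d → a +ℕ d ≡.≡ c +ℕ b → ι a - ι b ≈ ι c - ι d
    ι-cross a b c d eq = cross-sub (begin
      ι a + ι d   ≈⟨ ×-homo-+ 1# a d ⟨
      ι (a +ℕ d)  ≡⟨ ≡.cong ι eq ⟩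
      ι (c +ℕ b)  ≈⟨ ×-homo-+ 1# c b ⟩
      ι c + ι b   ∎)

    ∸-cross : ∀ a b → (a ∸ b) +ℕ b ≡.≡ a +ℕ (b ∸ a)
    ∸-cross zero    zero    = ≡.refl
    ∸-cross zero    (suc b) = ≡.refl
    ∸-cross (suc a) zero    = ≡.refl
    ∸-cross (suc a) (suc b) = ≡.trans (ℕ.+-suc (a ∸ b) b) (≡.cong suc (∸-cross a b))

    sub-interchange : ∀ x y z w → (x - y) + (z - w) ≈ (x + z) - (y + w)
    sub-interchange x y z w = trans (interchange x (- y) z (- w)) (+-congˡ (⁻¹-∙-comm y w))

    sub-product : ∀ x y z w → (x - y) * (z - w) ≈ (x * z + y * w) - (x * w + y * z)
    sub-product x y z w = begin
      (x - y) * (z - w)                  ≈⟨ x[y-z]≈xy-xz (x - y) z w ⟩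
      (x - y) * z - (x - y) * w          ≈⟨ +-cong ([y-z]x≈yx-zx z x y) (-‿cong ([y-z]x≈yx-zx w x y)) ⟩
      (x * z - y * z) - (x * w - y * w)  ≈⟨ +-congˡ (⁻¹-anti-homo‿- (x * w) (y * w)) ⟩
      (x * z - y * z) + (y * w - x * w)  ≈⟨ sub-interchange (x * z) (y * z) (y * w) (x * w) ⟩
      (x * z + y * w) - (y * z + x * w)  ≈⟨ +-congˡ (-‿cong (+-comm (y * z) (x * w))) ⟩
      (x * z + y * w) - (x * w + y * z)  ∎

    Diff : RawRing 0ℓ 0ℓ
    Diff = record
      { Carrier = ℕ × ℕ
      ; _≈_     = ≡._≡_
      ; _+_     = λ { (a , b) (c , d) → (a +ℕ c , b +ℕ d) }
      ; _*_     = λ { (a , b) (c , d) → (a *ℕ c +ℕ b *ℕ d , a *ℕ d +ℕ b *ℕ c) }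
      ; -_      = λ { (a , b) → (b , a) }
      ; 0#      = (0 , 0)
      ; 1#      = (1 , 0)
      }

    signed : ℕ → ℕ → Carrier
    signed m       zero    = ι m
    signed zero    (suc n) = - ι (suc n)
    signed (suc m) (suc n) = ι (suc m) - ι (suc n)

    signed-sound : ∀ m n → signed m n ≈ ι m - ι n
    signed-sound m       zero    = sym (trans (+-congˡ ε⁻¹≈ε) (+-identityʳ (ι m)))
    signed-sound zero    (suc n) = sym (+-identityˡ (- ι (suc n)))
    signed-sound (suc m) (suc n) = refl

    ⟦_⟧ : ℕ × ℕ → Carrier
    ⟦ (a , b) ⟧ = signed (a ∸ b) (b ∸ a)

    ⟦⟧-sound : ∀ a b → ⟦ (a , b) ⟧ ≈ ι a - ι b
    ⟦⟧-sound a b = trans (signed-sound (a ∸ b) (b ∸ a)) (ι-cross (a ∸ b) (b ∸ a) a b (∸-cross a b))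

    ι-bilinear : ∀ a b c d → ι (a *ℕ c +ℕ b *ℕ d) ≈ ι a * ι c + ι b * ι d
    ι-bilinear a b c d = trans (×-homo-+ 1# (a *ℕ c) (b *ℕ d)) (+-cong (×1-homo-* a c) (×1-homo-* b d))

    homomorphism : Diff -Raw-AlmostCommutative⟶ fromCommutativeRing R
    homomorphism = record
      { ⟦_⟧    = ⟦_⟧
      ; +-homo = λ { (a , b) (c , d) → begin
          ⟦ (a +ℕ c , b +ℕ d) ⟧        ≈⟨ ⟦⟧-sound (a +ℕ c) (b +ℕ d) ⟩
          ι (a +ℕ c) - ι (b +ℕ d)      ≈⟨ +-cong (×-homo-+ 1# a c) (-‿cong (×-homo-+ 1# b d)) ⟩
          (ι a + ι c) - (ι b + ι d)    ≈⟨ sub-interchange (ι a) (ι b) (ι c) (ι d) ⟨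
          (ι a - ι b) + (ι c - ι d)    ≈⟨ +-cong (⟦⟧-sound a b) (⟦⟧-sound c d) ⟨
          ⟦ (a , b) ⟧ + ⟦ (c , d) ⟧    ∎ }
      ; *-homo = λ { (a , b) (c , d) → begin
          ⟦ (a *ℕ c +ℕ b *ℕ d , a *ℕ d +ℕ b *ℕ c) ⟧
            ≈⟨ ⟦⟧-sound (a *ℕ c +ℕ b *ℕ d) (a *ℕ d +ℕ b *ℕ c) ⟩
          ι (a *ℕ c +ℕ b *ℕ d) - ι (a *ℕ d +ℕ b *ℕ c)
            ≈⟨ +-cong (ι-bilinear a b c d) (-‿cong (ι-bilinear a b d c)) ⟩
          (ι a * ι c + ι b * ι d) - (ι a * ι d + ι b * ι c)
            ≈⟨ sub-product (ι a) (ι b) (ι c) (ι d) ⟨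
          (ι a - ι b) * (ι c - ι d)
            ≈⟨ *-cong (⟦⟧-sound a b) (⟦⟧-sound c d) ⟨
          ⟦ (a , b) ⟧ * ⟦ (c , d) ⟧ ∎ }
      ; -‿homo = λ { (a , b) → begin
          ⟦ (b , a) ⟧    ≈⟨ ⟦⟧-sound b a ⟩
          ι b - ι a      ≈⟨ ⁻¹-anti-homo‿- (ι a) (ι b) ⟨
          - (ι a - ι b)  ≈⟨ -‿cong (⟦⟧-sound a b) ⟨
          - ⟦ (a , b) ⟧  ∎ }
      ; 0-homo = refl
      ; 1-homo = refl
      }

    decide : ∀ p q → Maybe (⟦ p ⟧ ≈ ⟦ q ⟧)
    decide (a , b) (c , d) with a +ℕ d ℕ.≟ c +ℕ b
    ... | yes eq = just (begin
      ⟦ (a , b) ⟧  ≈⟨ ⟦⟧-sound a b ⟩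
      ι a - ι b    ≈⟨ ι-cross a b c d eq ⟩
      ι c - ι d    ≈⟨ ⟦⟧-sound c d ⟨
      ⟦ (c , d) ⟧  ∎)
    ... | no _   = nothing

  open import Algebra.Solver.Ring Diff (fromCommutativeRing R) homomorphism decide public

  𝟘 𝟙 : ∀ {n} → Polynomial n
  𝟘 = con (0 , 0)
  𝟙 = con (1 , 0)

module OrderedFieldFacts {c ℓ₁ ℓ₂} (F : OrderedField c ℓ₁ ℓ₂) where
  open OrderedField F
  open DifferenceSolver commutativeRing
  open IsTotalOrder isTotalOrder using (total; antisym) renaming (reflexive to ≤-reflexive)

  poset : Poset c ℓ₁ ℓ₂
  poset = record { isPartialOrder = IsTotalOrder.isPartialOrder isTotalOrder }

  open import Relation.Binary.Reasoning.PartialOrder poset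

  x≤y⇒0≤y-x : ∀ {x y} → x ≤ y → 0# ≤ y - x
  x≤y⇒0≤y-x {x} {y} x≤y = begin
    0#     ≈⟨ -‿inverseʳ x ⟨
    x - x  ≤⟨ +-mono-≤ (- x) x≤y ⟩
    y - x  ∎

  0≤y-x⇒x≤y : ∀ {x y} → 0# ≤ y - x → x ≤ y
  0≤y-x⇒x≤y {x} {y} 0≤y-x = begin
    x            ≈⟨ +-identityˡ x ⟨
    0# + x       ≤⟨ +-mono-≤ x 0≤y-x ⟩
    (y - x) + x  ≈⟨ solve 2 (λ x y → (y :- x) :+ x := y) refl x y ⟩
    y            ∎

  +-monoˡ-≤ : ∀ z {x y} → x ≤ y → z + x ≤ z + y
  +-monoˡ-≤ z {x} {y} x≤y = begin
    z + x  ≈⟨ +-comm z x ⟩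
    x + z  ≤⟨ +-mono-≤ z x≤y ⟩
    y + z  ≈⟨ +-comm y z ⟩
    z + y  ∎

  +-mono₂-≤ : ∀ {x y z w} → x ≤ y → z ≤ w → x + z ≤ y + w
  +-mono₂-≤ {x} {y} {z} {w} x≤y z≤w = begin
    x + z  ≤⟨ +-mono-≤ z x≤y ⟩
    y + z  ≤⟨ +-monoˡ-≤ y z≤w ⟩
    y + w  ∎

  *-monoˡ-≤ : ∀ {x y z} → 0# ≤ z → x ≤ y → z * x ≤ z * y
  *-monoˡ-≤ {x} {y} {z} 0≤z x≤y = 0≤y-x⇒x≤y (begin
    0#               ≤⟨ *-nonneg 0≤z (x≤y⇒0≤y-x x≤y) ⟩
    z * (y - x)      ≈⟨ solve 3 (λ x y z → z :* (y :- x) := z :* y :- z :* x) refl x y z ⟩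
    z * y - z * x    ∎)

  *-monoʳ-≤ : ∀ {x y z} → 0# ≤ z → x ≤ y → x * z ≤ y * z
  *-monoʳ-≤ {x} {y} {z} 0≤z x≤y = begin
    x * z  ≈⟨ *-comm x z ⟩
    z * x  ≤⟨ *-monoˡ-≤ 0≤z x≤y ⟩
    z * y  ≈⟨ *-comm z y ⟩
    y * z  ∎

  square-nonneg : ∀ x → 0# ≤ x * x
  square-nonneg x with total 0# x
  ... | inj₁ 0≤x = *-nonneg 0≤x 0≤x
  ... | inj₂ x≤0 = begin
    0#           ≤⟨ *-nonneg 0≤-x 0≤-x ⟩
    (- x) * (- x) ≈⟨ solve 1 (λ x → (:- x) :* (:- x) := x :* x) refl x ⟩
    x * x        ∎
    where
    0≤-x : 0# ≤ - x
    0≤-x = begin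
      0#      ≤⟨ x≤y⇒0≤y-x x≤0 ⟩
      0# - x  ≈⟨ +-identityˡ (- x) ⟩
      - x     ∎

  0≤1 : 0# ≤ 1#
  0≤1 = begin
    0#       ≤⟨ square-nonneg 1# ⟩
    1# * 1#  ≈⟨ *-identityˡ 1# ⟩
    1#       ∎

  fromℕ-mono : ∀ {m n} → m ≤ℕ n → fromℕ m ≤ fromℕ n
  fromℕ-mono {n = zero}  z≤n     = ≤-reflexive refl
  fromℕ-mono {n = suc n} z≤n     = begin
    0#             ≈⟨ +-identityʳ 0# ⟨
    0# + 0#        ≤⟨ +-mono₂-≤ 0≤1 (fromℕ-mono {n = n} z≤n) ⟩
    fromℕ (suc n)  ∎
  fromℕ-mono (s≤s m≤n) = +-monoˡ-≤ 1# (fromℕ-mono m≤n)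

  1≤fromℕ-suc : ∀ n → 1# ≤ fromℕ (suc n)
  1≤fromℕ-suc n = begin
    1#             ≈⟨ +-identityʳ 1# ⟨
    1# + 0#        ≤⟨ +-monoˡ-≤ 1# (fromℕ-mono {n = n} z≤n) ⟩
    fromℕ (suc n)  ∎

  fromℕ-suc≉0 : ∀ n → ¬ (fromℕ (suc n) ≈ 0#)
  fromℕ-suc≉0 n r≈0 = 0≉1 (antisym 0≤1 (begin
    1#             ≤⟨ 1≤fromℕ-suc n ⟩
    fromℕ (suc n)  ≈⟨ r≈0 ⟩
    0#             ∎))

  -- -1 ≠ 0; this rules out the theorem's hypothesis for r = 0
  0≉0-1 : ¬ (0# ≈ 0# - 1#)
  0≉0-1 0≈-1 = 0≉1 (begin-equality
    0#               ≈⟨ solve 0 (𝟘 := 𝟙 :+ (𝟘 :- 𝟙)) refl ⟩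
    1# + (0# - 1#)   ≈⟨ +-congˡ 0≈-1 ⟨
    1# + 0#          ≈⟨ +-identityʳ 1# ⟩
    1#               ∎)

  inverse-nonneg : ∀ {x y} → 0# ≤ x → x * y ≈ 1# → 0# ≤ y
  inverse-nonneg {x} {y} 0≤x xy≈1 with total 0# y
  ... | inj₁ 0≤y = 0≤y
  ... | inj₂ y≤0 = ⊥-elim (0≉1 (antisym 0≤1 1≤0))
    where
    1≤0 : 1# ≤ 0#
    1≤0 = begin
      1#      ≈⟨ xy≈1 ⟨
      x * y   ≤⟨ *-monoˡ-≤ 0≤x y≤0 ⟩
      x * 0#  ≈⟨ zeroʳ x ⟩
      0#      ∎

  ^-nonneg : ∀ {x} k → 0# ≤ x → 0# ≤ x ^ k
  ^-nonneg zero    0≤x = 0≤1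
  ^-nonneg (suc k) 0≤x = *-nonneg 0≤x (^-nonneg k 0≤x)

  ^-congˡ : ∀ {x y} k → x ≈ y → x ^ k ≈ y ^ k
  ^-congˡ zero    x≈y = refl
  ^-congˡ (suc k) x≈y = *-cong x≈y (^-congˡ k x≈y)

  ∑-mono : ∀ n {f g : Fin n → Carrier} → (∀ i → f i ≤ g i) → ∑ n f ≤ ∑ n g
  ∑-mono zero    f≤g = ≤-reflexive refl
  ∑-mono (suc n) f≤g = +-mono₂-≤ (f≤g Fin.zero) (∑-mono n (λ i → f≤g (Fin.suc i)))

  ∑-affine : ∀ n (f : Fin n → Carrier) A B C →
             ∑ n (λ i → A + B * (f i - C)) ≈ fromℕ n * A + B * (∑ n f - fromℕ n * C)
  ∑-affine zero    f A B C =
    solve 3 (λ A B C → 𝟘 := 𝟘 :* A :+ B :* (𝟘 :- 𝟘 :* C)) refl A B C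
  ∑-affine (suc n) f A B C = trans (+-congˡ (∑-affine n (λ i → f (Fin.suc i)) A B C))
    (solve 6 (λ A B C x N s →
        A :+ B :* (x :- C) :+ (N :* A :+ B :* (s :- N :* C))
          := (𝟙 :+ N) :* A :+ B :* (x :+ s :- (𝟙 :+ N) :* C))
      refl A B C (f Fin.zero) (fromℕ n) (∑ n (λ i → f (Fin.suc i))))

-- Tangent lines of g k u = (1 - u) u ^ k at the point q = 1 - a.
module TangentLines {c ℓ₁ ℓ₂} (F : OrderedField c ℓ₁ ℓ₂) (a : OrderedField.Carrier F) where
  open OrderedField F
  open DifferenceSolver commutativeRing
  open OrderedFieldFacts F
  open import Relation.Binary.Reasoning.PartialOrder poset

  q : Carrier
  q = 1# - a

  -- slope k is the derivative of g k at q (g k q = q ^ k * a);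
  -- the recursion comes from g (suc k) u = u * g k u
  slope : ℕ → Carrier
  slope zero    = - 1#
  slope (suc k) = q * slope k + q ^ k * a

  tangent : ℕ → Carrier → Carrier
  tangent k u = q ^ k * a + slope k * (u - q)

  slope-closed : ∀ m → slope (suc m) ≈ q ^ m * (fromℕ (suc (suc m)) * a - 1#)
  slope-closed zero = solve 1 (λ a →
      (𝟙 :- a) :* (:- 𝟙) :+ 𝟙 :* a := 𝟙 :* ((𝟙 :+ (𝟙 :+ 𝟘)) :* a :- 𝟙))
    refl a
  slope-closed (suc m) = trans (+-congʳ (*-congˡ (slope-closed m)))
    (solve 4 (λ q P N a →
        q :* (P :* (N :* a :- 𝟙)) :+ q :* P :* a := q :* P :* ((𝟙 :+ N) :* a :- 𝟙))
      refl q (q ^ m) (fromℕ (suc (suc m))) a)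

  slope-nonpos : 0# ≤ q → ∀ k → fromℕ (suc k) * a ≤ 1# → slope k ≤ 0#
  slope-nonpos _   zero    _   = begin
    - 1#       ≈⟨ +-identityˡ (- 1#) ⟨
    0# - 1#    ≤⟨ +-mono-≤ (- 1#) 0≤1 ⟩
    1# - 1#    ≈⟨ -‿inverseʳ 1# ⟩
    0#         ∎
  slope-nonpos 0≤q (suc m) ka≤1 = begin
    slope (suc m)                              ≈⟨ slope-closed m ⟩
    q ^ m * (fromℕ (suc (suc m)) * a - 1#)     ≤⟨ *-monoˡ-≤ (^-nonneg m 0≤q) (+-mono-≤ (- 1#) ka≤1) ⟩
    q ^ m * (1# - 1#)                          ≈⟨ *-congˡ (-‿inverseʳ 1#) ⟩
    q ^ m * 0#                                 ≈⟨ zeroʳ (q ^ m) ⟩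
    0#                                         ∎

  tangent-step : ∀ k u → u * tangent k u ≈ tangent (suc k) u + slope k * ((u - q) * (u - q))
  tangent-step k u = solve 5 (λ u q a P s →
      u :* (P :* a :+ s :* (u :- q))
        := q :* P :* a :+ (q :* s :+ P :* a) :* (u :- q) :+ s :* ((u :- q) :* (u :- q)))
    refl u q a (q ^ k) (slope k)

  tangent-bound : 0# ≤ a → 0# ≤ q → ∀ k → fromℕ k * a ≤ 1# →
                  ∀ {u} → 0# ≤ u → (1# - u) * u ^ k ≤ tangent k u
  tangent-bound _   _   zero    _    {u} _   = begin
    (1# - u) * 1#  ≈⟨ solve 2 (λ u a → (𝟙 :- u) :* 𝟙 := 𝟙 :* a :+ (:- 𝟙) :* (u :- (𝟙 :- a))) refl u a ⟩
    tangent 0 u    ∎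
  tangent-bound 0≤a 0≤q (suc k) ka≤1 {u} 0≤u = begin
    (1# - u) * (u * u ^ k)     ≈⟨ solve 2 (λ u P → (𝟙 :- u) :* (u :* P) := u :* ((𝟙 :- u) :* P)) refl u (u ^ k) ⟩
    u * ((1# - u) * u ^ k)     ≤⟨ *-monoˡ-≤ 0≤u (tangent-bound 0≤a 0≤q k k·a≤1 0≤u) ⟩
    u * tangent k u            ≈⟨ tangent-step k u ⟩
    tangent (suc k) u + s·d²   ≤⟨ +-monoˡ-≤ _ s·d²≤0 ⟩
    tangent (suc k) u + 0#     ≈⟨ +-identityʳ _ ⟩
    tangent (suc k) u          ∎
    where
    s·d² : Carrier
    s·d² = slope k * ((u - q) * (u - q))

    s·d²≤0 : s·d² ≤ 0#
    s·d²≤0 = begin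
      s·d²                       ≤⟨ *-monoʳ-≤ (square-nonneg (u - q)) (slope-nonpos 0≤q k ka≤1) ⟩
      0# * ((u - q) * (u - q))   ≈⟨ zeroˡ _ ⟩
      0#                         ∎

    k·a≤1 : fromℕ k * a ≤ 1#
    k·a≤1 = begin
      fromℕ k * a        ≤⟨ *-monoʳ-≤ 0≤a (fromℕ-mono (ℕ.n≤1+n k)) ⟩
      fromℕ (suc k) * a  ≤⟨ ka≤1 ⟩
      1#                 ∎

  tangent-sum-bound : 0# ≤ a → 0# ≤ q → ∀ n (β : Fin n → Carrier) → (∀ i → 0# ≤ β i) →
                      ∑ n β ≈ fromℕ n * q → ∀ k → fromℕ k * a ≤ 1# →
                      ∑ n (λ i → (1# - β i) * β i ^ k) ≤ fromℕ n * a * q ^ k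
  tangent-sum-bound 0≤a 0≤q n β 0≤β ∑β≈nq k ka≤1 = begin
    ∑ n (λ i → (1# - β i) * β i ^ k)             ≤⟨ ∑-mono n (λ i → tangent-bound 0≤a 0≤q k ka≤1 (0≤β i)) ⟩
    ∑ n (λ i → tangent k (β i))                  ≈⟨ ∑-affine n β (q ^ k * a) (slope k) q ⟩
    N * (q ^ k * a) + slope k * (∑ n β - N * q)  ≈⟨ +-congˡ (*-congˡ (+-congʳ ∑β≈nq)) ⟩
    N * (q ^ k * a) + slope k * (N * q - N * q)
      ≈⟨ solve 5 (λ N P a s X → N :* (P :* a) :+ s :* (X :- X) := N :* a :* P)
           refl N (q ^ k) a (slope k) (N * q) ⟩
    N * a * q ^ k                                ∎
    where
    N : Carrier
    N = fromℕ n

-- The data of the theorem: r = suc n points, a = 1 / r and q = 1 - a = (r - 1) / r.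
module ReciprocalWeight {c ℓ₁ ℓ₂} (F : OrderedField c ℓ₁ ℓ₂) (n : ℕ) where
  open OrderedField F
  open DifferenceSolver commutativeRing
  open OrderedFieldFacts F
  open import Relation.Binary.Reasoning.PartialOrder poset

  R : Carrier
  R = fromℕ (suc n)

  open TangentLines F (R ⁻¹) public

  R·a≈1 : R * R ⁻¹ ≈ 1#
  R·a≈1 = ⁻¹-inverse R (fromℕ-suc≉0 n)

  0≤a : 0# ≤ R ⁻¹
  0≤a = inverse-nonneg (fromℕ-mono {n = suc n} z≤n) R·a≈1

  k·a≤1 : ∀ {k} → k ≤ℕ suc n → fromℕ k * R ⁻¹ ≤ 1#
  k·a≤1 {k} k≤r = begin
    fromℕ k * R ⁻¹  ≤⟨ *-monoʳ-≤ 0≤a (fromℕ-mono k≤r) ⟩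
    R * R ⁻¹        ≈⟨ R·a≈1 ⟩
    1#              ∎

  0≤q : 0# ≤ q
  0≤q = x≤y⇒0≤y-x (begin
    R ⁻¹            ≈⟨ *-identityˡ (R ⁻¹) ⟨
    1# * R ⁻¹       ≤⟨ *-monoʳ-≤ 0≤a (1≤fromℕ-suc n) ⟩
    R * R ⁻¹        ≈⟨ R·a≈1 ⟩
    1#              ∎)

  ratio≈q : (R - 1#) ÷ R ≈ q
  ratio≈q = begin-equality
    (R - 1#) * R ⁻¹        ≈⟨ solve 2 (λ R a → (R :- 𝟙) :* a := R :* a :- a) refl R (R ⁻¹) ⟩
    R * R ⁻¹ - R ⁻¹        ≈⟨ +-congʳ R·a≈1 ⟩
    1# - R ⁻¹              ∎

  -- r - 1 = r q, i.e. numbers summing to r - 1 have mean q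
  r-1≈r·q : R - 1# ≈ R * q
  r-1≈r·q = begin-equality
    R - 1#                 ≈⟨ +-congˡ (-‿cong R·a≈1) ⟨
    R - R * R ⁻¹           ≈⟨ solve 2 (λ R a → R :- R :* a := R :* (𝟙 :- a)) refl R (R ⁻¹) ⟩
    R * q                  ∎

lemma3p1 : ∀ {c ℓ₁ ℓ₂ : Level} (F : OrderedField c ℓ₁ ℓ₂) →
    let open OrderedField F in
    (r : ℕ) (β : Fin r → Carrier) →
    (∀ i → (0# ≤ β i) × (β i ≤ 1#)) →
    ∑ r β ≈ fromℕ r - 1# →
    (k : ℕ) → k ≤ℕ r →
    ∑ r (λ i → (1# - β i) * β i ^ k) ≤ ((fromℕ r - 1#) ÷ fromℕ r) ^ k
lemma3p1 F zero _ _ 0≈-1 _ _ = ⊥-elim (0≉0-1 0≈-1)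
  where open OrderedFieldFacts F
lemma3p1 F (suc n) β β∈[0,1] ∑β≈r-1 k k≤r = begin
    ∑ (suc n) (λ i → (1# - β i) * β i ^ k)
      ≤⟨ tangent-sum-bound 0≤a 0≤q (suc n) β (λ i → proj₁ (β∈[0,1] i))
           (trans ∑β≈r-1 r-1≈r·q) k (k·a≤1 k≤r) ⟩
    R * R ⁻¹ * q ^ k   ≈⟨ *-congʳ R·a≈1 ⟩
    1# * q ^ k         ≈⟨ *-identityˡ (q ^ k) ⟩
    q ^ k              ≈⟨ ^-congˡ k ratio≈q ⟨
    ((R - 1#) ÷ R) ^ k ∎
  where
  open OrderedField F
  open OrderedFieldFacts F
  open ReciprocalWeight F n
  open import Relation.Binary.Reasoning.PartialOrder poset
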